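{- Let $(A,\leq,{}',0,1)$ be a finite orthomodular poset, $(T,R)$ a time frame, $x\in(2^A\setminus\{\emptyset\})^T$, $B,C\in2^{(A^T)}\setminus\{\emptyset\}$ with $B\leq C$, and $s\in T$. Then: (i) $P(\varphi(x))(s)=\operatorname{Min}U(\bigcup\{x(t)\mid t\mathrel Rs\})$, $F(\varphi(x))(s)=\operatorname{Min}U(\bigcup\{x(t)\mid s\mathrel Rt\})$, $H(\varphi(x))(s)=\operatorname{Max}L(\bigcup\{x(t)\mid t\mathrel Rs\})$, $G(\varphi(x))(s)=\operatorname{Max}L(\bigcup\{x(t)\mid s\mathrel Rt\})$; (ii) $H(B)=P(B')'$ and $G(B)=F(B')'$; (iii) $P(B)\leq_2P(C)$, $F(B)\leq_2F(C)$, $H(B)\leq_1H(C)$ and $G(B)\leq_1G(C)$; (iv) $H(B)\leq P(B)$ and $G(B)\leq F(B)$.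
   Context: An orthomodular poset is a bounded poset $(A,\leq,0,1)$ with a unary operation ${}'$ that is an antitone involution and a complementation ($a\vee a'=1$, $a\wedge a'=0$), such that if $x\leq y'$ then $x\vee y$ exists, and if $x\leq y$ then $y=x\vee(y\wedge x')$. For $D\subseteq A$: $L(D)$, $U(D)$ are the sets of lower and upper bounds; $\operatorname{Max}D$, $\operatorname{Min}D$ the sets of maximal and minimal elements. A time frame is $(T,R)$ with $T\neq\emptyset$, $R\subseteq T^2$ serial (each $s$ has some $r\mathrel Rs$ and some $s\mathrel Rt$). Tense operators on nonempty $B\subseteq A^T$: $P(B)(s)=\operatorname{Min}U(\{q(t)\mid q\in B,t\mathrel Rs\})$, $F(B)(s)=\operatorname{Min}U(\{q(t)\mid q\in B,s\mathrel Rt\})$, $H(B)(s)=\operatorname{Max}L(\{q(t)\mid q\in B,t\mathrel Rs\})$, $G(B)(s)=\operatorname{Max}L(\{q(t)\mid q\in B,s\mathrel Rt\})$, with values in $(2^A\setminus\{\emptyset\})^T$. $\varphi(x)=\{q\in A^T\mid q(t)\in x(t)\ \forall t\}$. Complements: for $q\in A^T$, $q'(t)=(q(t))'$; for $y\in(2^A\setminus\{\emptyset\})^T$, $y'(t)=\{a'\mid a\in y(t)\}$; for $B\subseteq A^T$, $B'=\{q'\mid q\in B\}$. For nonempty $D,E\subseteq A$: $D\leq E$ iff $d\leq e$ for all $d\in D,e\in E$; $D\leq_1E$ iff $\forall d\,\exists e: d\leq e$; $D\leq_2E$ iff $\forall e\,\exists d: d\leq e$; for $y,z\in(2^A\setminus\{\emptyset\})^T$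 these are extended pointwise in $t\in T$. For nonempty $B,C\subseteq A^T$: $B\leq C$ iff $p(t)\leq q(t)$ for all $p\in B$, $q\in C$, $t\in T$. -}

module Defs where

open import Level using (0ℓ)
open import Data.Nat using (ℕ)
open import Data.Fin using (Fin)
open import Data.Product using (Σ; ∃; ∃-syntax; _×_; _,_)
open import Relation.Binary.PropositionalEquality using (_≡_)
open import Relation.Binary.Structures using (IsPartialOrder)
open import Relation.Unary using (Pred; _≐_)
open import Function.Bundles using (_↔_)

Subset : Set → Set₁
Subset A = Pred A 0ℓ

module _ {A : Set} (_≤_ : A → A → Set) where
  IsJoin : A → A → A → Set
  IsJoin x y j = (x ≤ j) × (y ≤ j) × (∀ u → x ≤ u → y ≤ u → j ≤ u)

  IsMeet : A → A → A → Set
  IsMeet x y m = (m ≤ x) × (m ≤ y) × (∀ l → l ≤ x → l ≤ y → l ≤ m)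

record OMP : Set₁ where
  field
    Carrier : Set
    _≤_     : Carrier → Carrier → Set
    isPartialOrder : IsPartialOrder _≡_ _≤_
    𝟎 𝟏     : Carrier
    𝟎-min   : ∀ a → 𝟎 ≤ a
    𝟏-max   : ∀ a → a ≤ 𝟏
    _′      : Carrier → Carrier
    antitone   : ∀ {a b} → a ≤ b → (b ′) ≤ (a ′)
    involutive : ∀ a → (a ′) ′ ≡ a
    join-compl : ∀ a → IsJoin _≤_ a (a ′) 𝟏
    meet-compl : ∀ a → IsMeet _≤_ a (a ′) 𝟎
    orthojoin  : ∀ {x y} → x ≤ (y ′) → ∃[ j ] IsJoin _≤_ x y j
    orthomodular : ∀ {x y} → x ≤ y →
      ∃[ m ] (IsMeet _≤_ y (x ′) m × IsJoin _≤_ x m y)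

Finite : OMP → Set
Finite O = ∃[ n ] (OMP.Carrier O ↔ Fin n)

record TimeFrame : Set₁ where
  field
    T : Set
    R : T → T → Set
    serial-past   : ∀ s → ∃[ r ] R r s
    serial-future : ∀ s → ∃[ t ] R s t

module Ops (O : OMP) (TF : TimeFrame) where
  open OMP O renaming (Carrier to A)
  open TimeFrame TF

  U : Subset A → Subset A
  U D a = ∀ d → D d → d ≤ a

  L : Subset A → Subset A
  L D a = ∀ d → D d → a ≤ d

  Max : Subset A → Subset A
  Max D a = D a × (∀ b → D b → a ≤ b → a ≡ b)

  Min : Subset A → Subset A
  Min D a = D a × (∀ b → D b → b ≤ a → b ≡ a)

  Nonempty : Subset A → Set
  Nonempty D = ∃[ a ] D a

  -- elements of A^T, subsets of A^T, elements of (2^A \ {∅})^T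
  Fun : Set
  Fun = T → A

  FunSet : Set₁
  FunSet = Pred Fun 0ℓ

  SetFun : Set₁
  SetFun = T → Subset A

  NonemptyFunSet : FunSet → Set
  NonemptyFunSet B = ∃[ q ] B q

  NonemptySetFun : SetFun → Set
  NonemptySetFun y = ∀ t → Nonempty (y t)

  pastVals : FunSet → T → Subset A
  pastVals B s a = ∃[ q ] ∃[ t ] (B q × R t s × a ≡ q t)

  futVals : FunSet → T → Subset A
  futVals B s a = ∃[ q ] ∃[ t ] (B q × R s t × a ≡ q t)

  P F H G : FunSet → SetFun
  P B s = Min (U (pastVals B s))
  F B s = Min (U (futVals B s))
  H B s = Max (L (pastVals B s))
  G B s = Max (L (futVals B s))

  φ : SetFun → FunSet
  φ x q = ∀ t → x t (q t)

  ⋃past : SetFun → T → Subset A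
  ⋃past x s a = ∃[ t ] (R t s × x t a)

  ⋃fut : SetFun → T → Subset A
  ⋃fut x s a = ∃[ t ] (R s t × x t a)

  compFun : Fun → Fun
  compFun q t = q t ′

  compSetFun : SetFun → SetFun
  compSetFun y t a = ∃[ b ] (y t b × a ≡ b ′)

  compFunSet : FunSet → FunSet
  compFunSet B q = ∃[ p ] (B p × q ≡ compFun p)

  _≐T_ : SetFun → SetFun → Set
  y ≐T z = ∀ t → y t ≐ z t

  _≤S_ _≤₁_ _≤₂_ : Subset A → Subset A → Set
  D ≤S E = ∀ d e → D d → E e → d ≤ e
  D ≤₁ E = ∀ d → D d → ∃[ e ] (E e × d ≤ e)
  D ≤₂ E = ∀ e → E e → ∃[ d ] (D d × d ≤ e)

  _≤T_ _≤₁T_ _≤₂T_ : SetFun → SetFun → Set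
  y ≤T z  = ∀ t → y t ≤S z t
  y ≤₁T z = ∀ t → y t ≤₁ z t
  y ≤₂T z = ∀ t → y t ≤₂ z t

  _≤F_ : FunSet → FunSet → Set
  B ≤F C = ∀ p q t → B p → C q → p t ≤ q t

module Submission where

-- Every value of x at a related time is taken by some selection in φ(x) (spliced together by
-- excluded middle, since equality of times is not decidable), so φ(x) has the same values as
-- the union of the x(t).  Complementation is an order anti-automorphism carrying upper bounds
-- of the values of B′ to lower bounds of the values of B, hence minima to maxima.  If B ≤ C,
-- every upper bound of the values of C bounds those of B, and in a finite poset each element
-- of a set lies above a minimal one; dually for lower bounds.  Finally, seriality makes the
-- value sets nonempty, and any lower bound of a nonempty set lies below any upper bound.

open import Defs
open import Level using (0ℓ)
open import Data.Fin using (Fin)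
open import Data.Fin.Induction using (po-wellFounded)
open import Data.Product using (∃-syntax; _×_; _,_; proj₁; proj₂)
open import Function.Bundles using (_↔_; Inverse)
open import Induction.WellFounded using (WellFounded; module Subrelation; module All)
open import Relation.Binary.PropositionalEquality using (_≡_; refl; sym; trans; cong; subst)
open import Relation.Binary.Structures using (IsPartialOrder)
open import Relation.Binary.Construct.NonStrictToStrict as ToStrict using ()
import Relation.Binary.Construct.Flip.EqAndOrd as Flip
import Relation.Binary.Construct.On as On
open import Relation.Nullary using (yes; no; contradiction)
open import Relation.Nullary.Decidable using (decidable-stable)
open import Relation.Unary using (Pred; _⊆_; _≐_)
open import Axiom.ExcludedMiddle using (ExcludedMiddle)

module FinitePartialOrder {A : Set} {_≤_ : A → A → Set}
                          (isPO : IsPartialOrder _≡_ _≤_) where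
  open IsPartialOrder isPO using () renaming (refl to ≤-refl; trans to ≤-trans)
  open ToStrict _≡_ _≤_ using (_<_)

  <-wellFounded : ∀ {n} → A ↔ Fin n → WellFounded _<_
  <-wellFounded A↔Fin = Subrelation.wellFounded <⇒<ᶠ
    (On.wellFounded to (po-wellFounded (On.isPartialOrder from isPO)))
    where
      open Inverse A↔Fin using (to; from; strictlyInverseʳ)
      <⇒<ᶠ : ∀ {a b} → a < b → from (to a) < from (to b)
      <⇒<ᶠ {a} {b} rewrite strictlyInverseʳ a | strictlyInverseʳ b = λ a<b → a<b

  minimal-below : ExcludedMiddle 0ℓ → WellFounded _<_ → (D : Pred A 0ℓ) →
    ∀ {a} → D a → ∃[ m ] ((D m × (∀ b → D b → b ≤ m → b ≡ m)) × m ≤ a)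
  minimal-below em wf D {a} = All.wfRec wf 0ℓ Goal step a
    where
      Goal : Pred A 0ℓ
      Goal a = D a → ∃[ m ] ((D m × (∀ b → D b → b ≤ m → b ≡ m)) × m ≤ a)
      step : ∀ a → (∀ {b} → b < a → Goal b) → Goal a
      step a rec Da with em {∃[ b ] (D b × b < a)}
      ... | yes (b , Db , b<a@(b≤a , _)) =
        let m , Min-m , m≤b = rec b<a Db in m , Min-m , ≤-trans m≤b b≤a
      ... | no ∄b<a = a , (Da , minimal) , ≤-refl
        where
          minimal : ∀ b → D b → b ≤ a → b ≡ a
          minimal b Db b≤a = decidable-stable em λ b≢a → ∄b<a (b , Db , b≤a , b≢a)

module OrderLemmas (O : OMP) (TF : TimeFrame) where
  open OMP O renaming (Carrier to A)
  open Ops O TF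
  open IsPartialOrder isPartialOrder using () renaming (trans to ≤-trans)

  U-resp-≐ : ∀ {D E} → D ≐ E → U D ≐ U E
  U-resp-≐ (D⊆E , E⊆D) = (λ u d Ed → u d (E⊆D Ed)) , (λ u d Dd → u d (D⊆E Dd))

  L-resp-≐ : ∀ {D E} → D ≐ E → L D ≐ L E
  L-resp-≐ (D⊆E , E⊆D) = (λ l d Ed → l d (E⊆D Ed)) , (λ l d Dd → l d (D⊆E Dd))

  Min-resp-≐ : ∀ {D E} → D ≐ E → Min D ≐ Min E
  Min-resp-≐ (D⊆E , E⊆D) = (λ (Dm , min) → D⊆E Dm , λ b Eb → min b (E⊆D Eb))
                         , (λ (Em , min) → E⊆D Em , λ b Db → min b (D⊆E Db))

  Max-resp-≐ : ∀ {D E} → D ≐ E → Max D ≐ Max E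
  Max-resp-≐ (D⊆E , E⊆D) = (λ (Dm , max) → D⊆E Dm , λ b Eb → max b (E⊆D Eb))
                         , (λ (Em , max) → E⊆D Em , λ b Db → max b (D⊆E Db))

  Max-L≤Min-U : ∀ {D} → Nonempty D → Max (L D) ≤S Min (U D)
  Max-L≤Min-U (d , Dd) l u (Ll , _) (Uu , _) = ≤-trans (Ll d Dd) (Uu d Dd)

  ≤′⇒≤′ : ∀ {a b} → a ≤ (b ′) → b ≤ (a ′)
  ≤′⇒≤′ {a} {b} a≤b′ = subst (_≤ (a ′)) (involutive b) (antitone a≤b′)

  ′≤⇒′≤ : ∀ {a b} → (a ′) ≤ b → (b ′) ≤ a
  ′≤⇒′≤ {a} {b} a′≤b = subst ((b ′) ≤_) (involutive a) (antitone a′≤b)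

  ≡′⇒≡′ : ∀ {a b} → a ≡ b ′ → b ≡ a ′
  ≡′⇒≡′ {a} {b} a≡b′ = trans (sym (involutive b)) (cong _′ (sym a≡b′))

  Max≐Min′ : ∀ {X Y : Subset A} → (∀ {b} → Y b → X (b ′)) → (∀ {b} → X (b ′) → Y b) →
             Max X ≐ (λ a → ∃[ b ] (Min Y b × a ≡ b ′))
  Max≐Min′ {X} {Y} Y⇒X′ X′⇒Y = to , from
    where
      X⇒Y′ : ∀ {a} → X a → Y (a ′)
      X⇒Y′ {a} Xa = X′⇒Y (subst X (sym (involutive a)) Xa)

      to : ∀ {a} → Max X a → ∃[ b ] (Min Y b × a ≡ b ′)
      to {a} (Xa , max) = a ′ , (X⇒Y′ Xa , minimal) , sym (involutive a)
        where
          minimal : ∀ c → Y c → c ≤ (a ′) → c ≡ a ′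
          minimal c Yc c≤a′ = ≡′⇒≡′ (max (c ′) (Y⇒X′ Yc) (≤′⇒≤′ c≤a′))

      from : ∀ {a} → ∃[ b ] (Min Y b × a ≡ b ′) → Max X a
      from {a} (b , (Yb , min) , a≡b′) = subst X (sym a≡b′) (Y⇒X′ Yb) , maximal
        where
          maximal : ∀ c → X c → a ≤ c → a ≡ c
          maximal c Xc a≤c =
            trans a≡b′ (sym (≡′⇒≡′ (sym (min (c ′) (X⇒Y′ Xc) (′≤⇒′≤ (subst (_≤ c) a≡b′ a≤c))))))

  module Finiteness (em : ExcludedMiddle 0ℓ) (finite : Finite O) where
    private
      module ≤ = FinitePartialOrder isPartialOrder
      module ≥ = FinitePartialOrder (Flip.isPartialOrder isPartialOrder)

    Min-below : ∀ D {a} → D a → ∃[ m ] (Min D m × m ≤ a)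
    Min-below D = ≤.minimal-below em (≤.<-wellFounded (proj₂ finite)) D

    Max-above : ∀ D {a} → D a → ∃[ m ] (Max D m × a ≤ m)
    Max-above D Da =
      let m , (Dm , min) , a≤m = ≥.minimal-below em (≥.<-wellFounded (proj₂ finite)) D Da
      in m , (Dm , λ b Db m≤b → sym (min b Db m≤b)) , a≤m

    ⊆⇒Min-≤₂ : ∀ {D E} → E ⊆ D → Min D ≤₂ Min E
    ⊆⇒Min-≤₂ {D} E⊆D e (Ee , _) = Min-below D (E⊆D Ee)

    ⊆⇒Max-≤₁ : ∀ {D E} → D ⊆ E → Max D ≤₁ Max E
    ⊆⇒Max-≤₁ {E = E} D⊆E d (Dd , _) = Max-above E (D⊆E Dd)

module TenseLemmas (O : OMP) (TF : TimeFrame) where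
  open OMP O renaming (Carrier to A)
  open Ops O TF
  open TimeFrame TF
  open IsPartialOrder isPartialOrder using () renaming (trans to ≤-trans)
  open OrderLemmas O TF using (′≤⇒′≤)

  -- pastVals B s and futVals B s are valuesAt (λ t → R t s) B and valuesAt (R s) B.
  valuesAt : (T → Set) → FunSet → Subset A
  valuesAt K B a = ∃[ q ] ∃[ t ] (B q × K t × a ≡ q t)

  unionAt : (T → Set) → SetFun → Subset A
  unionAt K x a = ∃[ t ] (K t × x t a)

  valuesAt-nonempty : ∀ {K B} → ∃[ t ] K t → NonemptyFunSet B → Nonempty (valuesAt K B)
  valuesAt-nonempty (t , Kt) (q , Bq) = q t , q , t , Bq , Kt , refl

  module _ (em : ExcludedMiddle 0ℓ) {x : SetFun} (x-nonempty : NonemptySetFun x) where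

    selectionThrough : T → A → Fun
    selectionThrough t a t′ with em {t′ ≡ t}
    ... | yes _ = a
    ... | no  _ = proj₁ (x-nonempty t′)

    selectionThrough-at : ∀ t a → selectionThrough t a t ≡ a
    selectionThrough-at t a with em {t ≡ t}
    ... | yes _ = refl
    ... | no t≢t = contradiction refl t≢t

    selectionThrough-∈φ : ∀ {t a} → x t a → φ x (selectionThrough t a)
    selectionThrough-∈φ {t} x[t]a t′ with em {t′ ≡ t}
    ... | yes refl = x[t]a
    ... | no  _    = proj₂ (x-nonempty t′)

    valuesAt-φ : ∀ K → valuesAt K (φ x) ≐ unionAt K x
    valuesAt-φ K = (λ (q , t , φq , Kt , a≡qt) → t , Kt , subst (x t) (sym a≡qt) (φq t))
                 , (λ {a} (t , Kt , x[t]a) → selectionThrough t a , t , selectionThrough-∈φ x[t]a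
                                           , Kt , sym (selectionThrough-at t a))

  U-valuesAt-compl⇒L : ∀ {K B b} → U (valuesAt K (compFunSet B)) b → L (valuesAt K B) (b ′)
  U-valuesAt-compl⇒L {b = b} U[b] a (q , t , Bq , Kt , a≡qt) =
    subst ((b ′) ≤_) (sym a≡qt) (′≤⇒′≤ (U[b] (q t ′) (compFun q , t , (q , Bq , refl) , Kt , refl)))

  L-valuesAt⇒U-compl : ∀ {K B b} → L (valuesAt K B) (b ′) → U (valuesAt K (compFunSet B)) b
  L-valuesAt⇒U-compl {b = b} L[b′] a (q , t , (p , Bp , refl) , Kt , refl) =
    ′≤⇒′≤ (L[b′] (p t) (p , t , Bp , Kt , refl))

  ≤F⇒U-valuesAt-⊇ : ∀ {K B C} → NonemptyFunSet C → B ≤F C → U (valuesAt K C) ⊆ U (valuesAt K B)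
  ≤F⇒U-valuesAt-⊇ (q , Cq) B≤C U[e] a (p , t , Bp , Kt , refl) =
    ≤-trans (B≤C p q t Bp Cq) (U[e] (q t) (q , t , Cq , Kt , refl))

  ≤F⇒L-valuesAt-⊆ : ∀ {K B C} → NonemptyFunSet B → B ≤F C → L (valuesAt K B) ⊆ L (valuesAt K C)
  ≤F⇒L-valuesAt-⊆ (p , Bp) B≤C L[d] a (q , t , Cq , Kt , refl) =
    ≤-trans (L[d] (p t) (p , t , Bp , Kt , refl)) (B≤C p q t Bp Cq)

proposition10 : ExcludedMiddle 0ℓ →
    (O : OMP) → Finite O → (TF : TimeFrame) →
    let open Ops O TF
        open TimeFrame TF
    in (x : SetFun) → NonemptySetFun x →
       (B C : FunSet) → NonemptyFunSet B → NonemptyFunSet C → B ≤F C →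
       (s : T) →
       ((P (φ x) s ≐ Min (U (⋃past x s)))
        × (F (φ x) s ≐ Min (U (⋃fut x s)))
        × (H (φ x) s ≐ Max (L (⋃past x s)))
        × (G (φ x) s ≐ Max (L (⋃fut x s))))
       × ((H B ≐T compSetFun (P (compFunSet B)))
        × (G B ≐T compSetFun (F (compFunSet B))))
       × ((P B ≤₂T P C) × (F B ≤₂T F C) × (H B ≤₁T H C) × (G B ≤₁T G C))
       × ((H B ≤T P B) × (G B ≤T F B))
proposition10 em O finite TF x x-nonempty B C B-nonempty C-nonempty B≤C s =
  ( (Min-resp-≐ (U-resp-≐ past-φ) , Min-resp-≐ (U-resp-≐ future-φ)
    , Max-resp-≐ (L-resp-≐ past-φ) , Max-resp-≐ (L-resp-≐ future-φ))
  , ( (λ _ → Max≐Min′ U-valuesAt-compl⇒L L-valuesAt⇒U-compl)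
    , (λ _ → Max≐Min′ U-valuesAt-compl⇒L L-valuesAt⇒U-compl))
  , ( (λ _ → ⊆⇒Min-≤₂ (≤F⇒U-valuesAt-⊇ C-nonempty B≤C))
    , (λ _ → ⊆⇒Min-≤₂ (≤F⇒U-valuesAt-⊇ C-nonempty B≤C))
    , (λ _ → ⊆⇒Max-≤₁ (≤F⇒L-valuesAt-⊆ B-nonempty B≤C))
    , (λ _ → ⊆⇒Max-≤₁ (≤F⇒L-valuesAt-⊆ B-nonempty B≤C)))
  , ( (λ t → Max-L≤Min-U (valuesAt-nonempty (serial-past t) B-nonempty))
    , (λ t → Max-L≤Min-U (valuesAt-nonempty (serial-future t) B-nonempty))))
  where
    open Ops O TF
    open TimeFrame TF
    open OrderLemmas O TF
    open Finiteness em finite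
    open TenseLemmas O TF

    past-φ : pastVals (φ x) s ≐ ⋃past x s
    past-φ = valuesAt-φ em x-nonempty (λ t → R t s)

    future-φ : futVals (φ x) s ≐ ⋃fut x s
    future-φ = valuesAt-φ em x-nonempty (R s)
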